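{- Let $\mathbf A$ be an $l$-factor, $i=\mathrm{root}(\mathbf A)$, $L=\{x\in\mathrm{ind}(\mathbf A):x<i\}$ and $R=\{x\in\mathrm{ind}(\mathbf A):x>i\}$. Then there exist $l$-factors $\mathbf A_L$ (when $L\ne\emptyset$) with $\mathrm{ind}(\mathbf A_L)=L$ and $\mathbf A_R$ (when $R\neq\emptyset$) with $\mathrm{ind}(\mathbf A_R)=R$ such that: if $L,R\ne\emptyset$ then $\mathbf A=_{\mathcal I}(\mathbf 2^i\circ_2\mathbf A_R)\circ_1\mathbf A_L$; if $L=\emptyset\ne R$ then $\mathbf A=_{\mathcal I}\mathbf 2^i\circ_2\mathbf A_R$; if $R=\emptyset\ne L$ then $\mathbf A=_{\mathcal I}\mathbf 2^i\circ_1\mathbf A_L$; and if $\mathrm{ind}(\mathbf A)=\{i\}$ then $\mathbf A=\mathbf 2^i$.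
   Context: Indexed terms: $\mathcal L^I$ is generated by symbols $\mathbf 2^k$ ($k$ a positive integer) of arity $2$, and for terms $\mathbf A,\mathbf B$ and $1\le m\le|\mathbf A|$ the term $\mathbf A\circ_m\mathbf B$ of arity $|\mathbf A|+|\mathbf B|-1$; no index occurs more than once in a term. $\mathrm{ind}(\mathbf A)$ is the set of indices occurring in $\mathbf A$. $=_{\mathcal I}$ is the smallest congruence on $\mathcal L^I$ containing all instances of (assoc1) $(\mathbf A\circ_n\mathbf B)\circ_m\mathbf C=\mathbf A\circ_n(\mathbf B\circ_{m-n+1}\mathbf C)$ if $n\le m<n+|\mathbf B|$, and (assoc2) $(\mathbf A\circ_n\mathbf B)\circ_m\mathbf C=(\mathbf A\circ_{m-|\mathbf B|+1}\mathbf C)\circ_n\mathbf B$ if $n+|\mathbf B|\le m$. $l$-factors are defined recursively: each $\mathbf 2^k$ is an $l$-factor; if $\mathbf A$ is an $l$-factor, $j\notin\mathrm{ind}(\mathbf A)$ and $r=|\{x\in\mathrm{ind}(\mathbf A):x<j\}|+1$, then $\mathbf A\circ_r\mathbf 2^j$ is an $l$-factor. The root index is defined by $\mathrm{root}(\mathbf 2^i)=i$ and $\mathrm{root}(\mathbf A\circ_r\mathbf 2^j)=\mathrm{root}(\mathbf A)$. -}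

module Defs where

open import Data.Nat using (ℕ; zero; suc; _+_; _∸_; _≤_; _<_; _<?_)
open import Data.List using (List; []; _∷_; _++_; filter; length)
open import Data.List.Membership.Propositional using (_∈_; _∉_)
open import Data.Product using (_×_)

data Term : Set where
  two    : ℕ → Term
  _∘[_]_ : Term → ℕ → Term → Term

infixl 5 _∘[_]_

∣_∣ : Term → ℕ
∣ two k ∣ = 2
∣ A ∘[ m ] B ∣ = ∣ A ∣ + ∣ B ∣ ∸ 1

ind : Term → List ℕ
ind (two k) = k ∷ []
ind (A ∘[ m ] B) = ind A ++ ind B

Disjoint : List ℕ → List ℕ → Set
Disjoint xs ys = ∀ {x} → x ∈ xs → x ∉ ys

-- Membership in L^I: indices positive, 1 ≤ m ≤ |A|, no index repeated.
data WF : Term → Set where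
  wf-two  : ∀ {k} → 1 ≤ k → WF (two k)
  wf-comp : ∀ {A B m} → WF A → WF B → 1 ≤ m → m ≤ ∣ A ∣ →
            Disjoint (ind A) (ind B) → WF (A ∘[ m ] B)

data _=I_ : Term → Term → Set where
  ≈refl  : ∀ {A} → WF A → A =I A
  ≈sym   : ∀ {A B} → A =I B → B =I A
  ≈trans : ∀ {A B C} → A =I B → B =I C → A =I C
  ≈cong  : ∀ {A A′ B B′ m} → WF (A ∘[ m ] B) → A =I A′ → B =I B′ →
           (A ∘[ m ] B) =I (A′ ∘[ m ] B′)
  assoc1 : ∀ {A B C n m} → WF ((A ∘[ n ] B) ∘[ m ] C) →
           n ≤ m → m < n + ∣ B ∣ →
           ((A ∘[ n ] B) ∘[ m ] C) =I (A ∘[ n ] (B ∘[ m ∸ n + 1 ] C))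
  assoc2 : ∀ {A B C n m} → WF ((A ∘[ n ] B) ∘[ m ] C) →
           n + ∣ B ∣ ≤ m →
           ((A ∘[ n ] B) ∘[ m ] C) =I ((A ∘[ m ∸ ∣ B ∣ + 1 ] C) ∘[ n ] B)

infix 4 _=I_

countBelow : ℕ → Term → ℕ
countBelow j A = length (filter (_<? j) (ind A))

data LFactor : Term → Set where
  lf-two  : ∀ {k} → 1 ≤ k → LFactor (two k)
  lf-step : ∀ {A j} → LFactor A → 1 ≤ j → j ∉ ind A →
            LFactor (A ∘[ suc (countBelow j A) ] two j)

root : Term → ℕ
root (two i) = i
root (A ∘[ m ] B) = root A

{-# OPTIONS --safe #-}
-- Induction along the l-factor, maintaining A =I (2^i ∘₂ A_R) ∘₁ A_L, whose first |A_L| inputs belong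
-- to A_L and the remaining ones to A_R. A step A ∘_r 2^j grafts at r = 1 + |{x ∈ ind A : x < j}|. As
-- L < i < R, for j < i only indices of L are counted, so r is j's grafting position inside A_L and (assoc1)
-- pushes 2^j into A_L; for j > i all of L and i are counted, so r = |A_L| + r′ with r′ j's grafting
-- position inside A_R, and (assoc2) followed by (assoc1) pushes 2^j into A_R.
module Submission where

open import Defs
open import Data.Nat using (ℕ; suc; _+_; _∸_; _≤_; _<_; z≤n; s≤s)
open import Data.Nat.Properties
open import Data.Product using (Σ; _×_; ∃; ∃₂; _,_; proj₁; proj₂)
open import Data.Sum using (inj₁; inj₂)
open import Data.Empty using (⊥-elim)
open import Data.List using (List; _∷_; []; _++_; _∷ʳ_; length; filter)
open import Data.List.Properties
  using ( length-++; ++-identityʳ; ++-assoc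
        ; length-filter; filter-accept; filter-reject; filter-all; filter-none; filter-++)
open import Data.List.Membership.Propositional using (_∈_; _∉_)
open import Data.List.Membership.Propositional.Properties using (∈-++⁺ˡ; ∈-++⁺ʳ; ∈-++⁻)
open import Data.List.Relation.Unary.All as All using (All)
open import Data.List.Relation.Unary.All.Properties using (∷ʳ⁺)
open import Data.List.Relation.Unary.Any using (here; there)
open import Data.List.Relation.Unary.Any.Properties using (singleton⁻)
open import Data.List.Relation.Binary.Permutation.Propositional
  using (_↭_; ↭-refl; ↭-sym; ↭-trans; ↭-reflexive; module PermutationReasoning)
open import Data.List.Relation.Binary.Permutation.Propositional.Properties
  using (++⁺; ++⁺ˡ; ++-comm; ↭-length; filter-↭; ∈-resp-↭)
open import Data.Maybe using (Maybe; just; nothing; maybe)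
import Data.Maybe.Relation.Unary.All as Maybe
open import Relation.Nullary using (¬_)
open import Relation.Binary.Definitions using (tri<; tri≈; tri>)
open import Relation.Binary.PropositionalEquality
  using (_≡_; refl; sym; trans; cong; cong₂; subst; module ≡-Reasoning)
open import Function.Bundles using (_⇔_; mk⇔; Equivalence)
open Equivalence using (to; from)

private
  variable
    A B C X Y Y′ : Term
    i j k m n : ℕ

∣∣≡1+length-ind : ∀ X → ∣ X ∣ ≡ suc (length (ind X))
∣∣≡1+length-ind (two k) = refl
∣∣≡1+length-ind (A ∘[ m ] B) = begin
  ∣ A ∣ + ∣ B ∣ ∸ 1  ≡⟨ cong₂ (λ a b → a + b ∸ 1) (∣∣≡1+length-ind A) (∣∣≡1+length-ind B) ⟩
  a + suc b          ≡⟨ +-suc a b ⟩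
  suc (a + b)        ≡⟨ cong suc (sym (length-++ (ind A))) ⟩
  suc (length (ind A ++ ind B)) ∎
  where
  open ≡-Reasoning
  a b : ℕ
  a = length (ind A)
  b = length (ind B)

1≤∣∣ : ∀ X → 1 ≤ ∣ X ∣
1≤∣∣ X = subst (1 ≤_) (sym (∣∣≡1+length-ind X)) (s≤s z≤n)

root∈ind : ∀ X → root X ∈ ind X
root∈ind (two k) = here refl
root∈ind (A ∘[ m ] B) = ∈-++⁺ˡ (root∈ind A)

disjoint-resp-↭ : ∀ {xs ys xs′ ys′} →
                  xs ↭ xs′ → ys ↭ ys′ → Disjoint xs ys → Disjoint xs′ ys′
disjoint-resp-↭ p q d x∈xs′ x∈ys′ =
  d (∈-resp-↭ (↭-sym p) x∈xs′) (∈-resp-↭ (↭-sym q) x∈ys′)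

disjoint-++⁺ˡ : ∀ {xs ys zs} → Disjoint xs zs → Disjoint ys zs → Disjoint (xs ++ ys) zs
disjoint-++⁺ˡ {xs} d e x∈xsys with ∈-++⁻ xs x∈xsys
... | inj₁ x∈xs = d x∈xs
... | inj₂ x∈ys = e x∈ys

disjoint-++⁺ʳ : ∀ {xs ys zs} → Disjoint xs ys → Disjoint xs zs → Disjoint xs (ys ++ zs)
disjoint-++⁺ʳ {ys = ys} d e x∈xs x∈yszs with ∈-++⁻ ys x∈yszs
... | inj₁ x∈ys = d x∈xs x∈ys
... | inj₂ x∈zs = e x∈xs x∈zs

=I⇒ind-↭ : X =I Y → ind X ↭ ind Y
=I⇒ind-↭ (≈refl _) = ↭-refl
=I⇒ind-↭ (≈sym p) = ↭-sym (=I⇒ind-↭ p)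
=I⇒ind-↭ (≈trans p q) = ↭-trans (=I⇒ind-↭ p) (=I⇒ind-↭ q)
=I⇒ind-↭ (≈cong _ p q) = ++⁺ (=I⇒ind-↭ p) (=I⇒ind-↭ q)
=I⇒ind-↭ (assoc1 {A} {B} {C} _ _ _) = ↭-reflexive (++-assoc (ind A) (ind B) (ind C))
=I⇒ind-↭ (assoc2 {A} {B} {C} _ _) = begin
  (ind A ++ ind B) ++ ind C  ≡⟨ ++-assoc (ind A) (ind B) (ind C) ⟩
  ind A ++ ind B ++ ind C    ↭⟨ ++⁺ˡ (ind A) (++-comm (ind B) (ind C)) ⟩
  ind A ++ ind C ++ ind B    ≡⟨ ++-assoc (ind A) (ind C) (ind B) ⟨
  (ind A ++ ind C) ++ ind B  ∎
  where open PermutationReasoning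

=I⇒∣∣≡ : X =I Y → ∣ X ∣ ≡ ∣ Y ∣
=I⇒∣∣≡ {X} {Y} p = begin
  ∣ X ∣                   ≡⟨ ∣∣≡1+length-ind X ⟩
  suc (length (ind X))    ≡⟨ cong suc (↭-length (=I⇒ind-↭ p)) ⟩
  suc (length (ind Y))    ≡⟨ ∣∣≡1+length-ind Y ⟨
  ∣ Y ∣                   ∎
  where open ≡-Reasoning

m≤m+n∸1 : ∀ m {n} → 1 ≤ n → m ≤ m + n ∸ 1
m≤m+n∸1 m {n} 1≤n = subst (m ≤_) (sym (+-∸-assoc m 1≤n)) (m≤m+n m (n ∸ 1))

m≤a+b∸1⇒m∸b+1≤a : ∀ {m a} b → 1 ≤ a → m ≤ a + b ∸ 1 → m ∸ b + 1 ≤ a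
m≤a+b∸1⇒m∸b+1≤a {m} {suc a} b _ m≤a+b =
  subst (_≤ suc a) (+-comm 1 (m ∸ b)) (s≤s (m≤n+o⇒m∸n≤o m b (subst (m ≤_) (+-comm a b) m≤a+b)))

wf-assoc1 : WF ((A ∘[ n ] B) ∘[ m ] C) → n ≤ m → m < n + ∣ B ∣ →
            WF (A ∘[ n ] (B ∘[ m ∸ n + 1 ] C))
wf-assoc1 {A} {n} {B} {m} (wf-comp (wf-comp wA wB 1≤n n≤∣A∣ dAB) wC _ _ dABC) n≤m m<n+∣B∣ =
  wf-comp wA
    (wf-comp wB wC (m≤n+m 1 (m ∸ n)) m∸n+1≤∣B∣ (λ x∈B → dABC (∈-++⁺ʳ (ind A) x∈B)))
    1≤n n≤∣A∣ (disjoint-++⁺ʳ dAB (λ x∈A → dABC (∈-++⁺ˡ x∈A)))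
  where
  m∸n+1≤∣B∣ : m ∸ n + 1 ≤ ∣ B ∣
  m∸n+1≤∣B∣ = subst (_≤ ∣ B ∣) (+-comm 1 (m ∸ n))
    (subst (m ∸ n <_) (m+n∸m≡n n ∣ B ∣) (∸-monoˡ-< m<n+∣B∣ n≤m))

wf-assoc2 : WF ((A ∘[ n ] B) ∘[ m ] C) → n + ∣ B ∣ ≤ m →
            WF ((A ∘[ m ∸ ∣ B ∣ + 1 ] C) ∘[ n ] B)
wf-assoc2 {A} {n} {B} {m} {C} (wf-comp (wf-comp wA wB 1≤n n≤∣A∣ dAB) wC _ m≤∣AB∣ dABC) _ =
  wf-comp
    (wf-comp wA wC (m≤n+m 1 (m ∸ ∣ B ∣)) (m≤a+b∸1⇒m∸b+1≤a ∣ B ∣ (1≤∣∣ A) m≤∣AB∣)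
      (λ x∈A → dABC (∈-++⁺ˡ x∈A)))
    wB 1≤n (≤-trans n≤∣A∣ (m≤m+n∸1 ∣ A ∣ (1≤∣∣ C)))
    (disjoint-++⁺ˡ dAB (λ x∈C x∈B → dABC (∈-++⁺ʳ (ind A) x∈B) x∈C))

=I⇒WF : X =I Y → WF X × WF Y
=I⇒WF (≈refl w) = w , w
=I⇒WF (≈sym p) = proj₂ (=I⇒WF p) , proj₁ (=I⇒WF p)
=I⇒WF (≈trans p q) = proj₁ (=I⇒WF p) , proj₂ (=I⇒WF q)
=I⇒WF (≈cong w@(wf-comp _ _ 1≤m m≤∣A∣ d) p q) =
  w , wf-comp (proj₂ (=I⇒WF p)) (proj₂ (=I⇒WF q)) 1≤m (subst (_ ≤_) (=I⇒∣∣≡ p) m≤∣A∣)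
        (disjoint-resp-↭ (=I⇒ind-↭ p) (=I⇒ind-↭ q) d)
=I⇒WF (assoc1 w n≤m m<n+∣B∣) = w , wf-assoc1 w n≤m m<n+∣B∣
=I⇒WF (assoc2 w n+∣B∣≤m) = w , wf-assoc2 w n+∣B∣≤m

assoc1-at : WF ((A ∘[ n ] B) ∘[ n + k ] C) → k < ∣ B ∣ →
            (A ∘[ n ] B) ∘[ n + k ] C =I A ∘[ n ] (B ∘[ suc k ] C)
assoc1-at {A} {n} {B} {k} {C} w k<∣B∣ =
  subst (λ p → (A ∘[ n ] B) ∘[ n + k ] C =I A ∘[ n ] (B ∘[ p ] C)) n+k∸n+1≡1+k
    (assoc1 w (m≤m+n n k) (+-monoʳ-< n k<∣B∣))
  where
  n+k∸n+1≡1+k : n + k ∸ n + 1 ≡ suc k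
  n+k∸n+1≡1+k = trans (cong (_+ 1) (m+n∸m≡n n k)) (+-comm k 1)

assoc2-at : WF ((A ∘[ n ] B) ∘[ suc (length (ind B) + k) ] C) → n ≤ k →
            (A ∘[ n ] B) ∘[ suc (length (ind B) + k) ] C =I (A ∘[ suc k ] C) ∘[ n ] B
assoc2-at {A} {n} {B} {k} {C} w n≤k =
  subst (λ p → (A ∘[ n ] B) ∘[ suc (b + k) ] C =I (A ∘[ p ] C) ∘[ n ] B) position (assoc2 w bound)
  where
  b : ℕ
  b = length (ind B)
  bound : n + ∣ B ∣ ≤ suc (b + k)
  bound = begin
    n + ∣ B ∣      ≡⟨ cong (n +_) (∣∣≡1+length-ind B) ⟩
    n + suc b      ≡⟨ +-suc n b ⟩
    suc (n + b)    ≤⟨ s≤s (+-monoˡ-≤ b n≤k) ⟩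
    suc (k + b)    ≡⟨ cong suc (+-comm k b) ⟩
    suc (b + k)    ∎
    where open ≤-Reasoning
  position : suc (b + k) ∸ ∣ B ∣ + 1 ≡ suc k
  position = begin
    suc (b + k) ∸ ∣ B ∣ + 1   ≡⟨ cong (λ a → suc (b + k) ∸ a + 1) (∣∣≡1+length-ind B) ⟩
    b + k ∸ b + 1             ≡⟨ cong (_+ 1) (m+n∸m≡n b k) ⟩
    k + 1                     ≡⟨ +-comm k 1 ⟩
    suc k                     ∎
    where open ≡-Reasoning

count< : ℕ → List ℕ → ℕ
count< j xs = length (filter (_<? j) xs)

countBelow<∣∣ : ∀ j X → countBelow j X < ∣ X ∣
countBelow<∣∣ j X =
  subst (countBelow j X <_) (sym (∣∣≡1+length-ind X)) (s≤s (length-filter (_<? j) (ind X)))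

count<-resp-↭ : ∀ j {xs ys} → xs ↭ ys → count< j xs ≡ count< j ys
count<-resp-↭ j xs↭ys = ↭-length (filter-↭ (_<? j) xs↭ys)

count<-∷-++-above : ∀ {xs} ys → j < i → All (i <_) xs → count< j (i ∷ xs ++ ys) ≡ count< j ys
count<-∷-++-above {j} {i} {xs} ys j<i i<xs = begin
  length (keep (i ∷ xs ++ ys))   ≡⟨ cong length (filter-reject (_<? j) (<⇒≯ j<i)) ⟩
  length (keep (xs ++ ys))       ≡⟨ cong length (filter-++ (_<? j) xs ys) ⟩
  length (keep xs ++ keep ys)    ≡⟨ cong (λ zs → length (zs ++ keep ys)) none-kept ⟩
  length (keep ys)               ∎
  where
  open ≡-Reasoning
  keep : List ℕ → List ℕ
  keep = filter (_<? j)
  none-kept : keep xs ≡ []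
  none-kept = filter-none (_<? j) (All.map (λ i<x → <⇒≯ (<-trans j<i i<x)) i<xs)

count<-∷-++-below : ∀ xs {ys} → i < j → All (_< i) ys →
                    count< j (i ∷ xs ++ ys) ≡ length ys + suc (count< j xs)
count<-∷-++-below {i} {j} xs {ys} i<j ys<i = begin
  length (keep (i ∷ xs ++ ys))       ≡⟨ cong length (filter-accept (_<? j) i<j) ⟩
  suc (length (keep (xs ++ ys)))     ≡⟨ cong (λ zs → suc (length zs)) (filter-++ (_<? j) xs ys) ⟩
  suc (length (keep xs ++ keep ys))  ≡⟨ cong (λ zs → suc (length (keep xs ++ zs))) all-kept ⟩
  suc (length (keep xs ++ ys))       ≡⟨ cong suc (length-++ (keep xs)) ⟩
  suc (count< j xs + length ys)      ≡⟨ cong suc (+-comm (count< j xs) (length ys)) ⟩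
  suc (length ys + count< j xs)      ≡⟨ +-suc (length ys) (count< j xs) ⟨
  length ys + suc (count< j xs)      ∎
  where
  open ≡-Reasoning
  keep : List ℕ → List ℕ
  keep = filter (_<? j)
  all-kept : keep ys ≡ ys
  all-kept = filter-all (_<? j) (All.map (λ x<i → <-trans x<i i<j) ys<i)

lfactor⇒WF : LFactor A → WF A
lfactor⇒WF (lf-two 1≤k) = wf-two 1≤k
lfactor⇒WF (lf-step {A} {j} lf 1≤j j∉A) =
  wf-comp (lfactor⇒WF lf) (wf-two 1≤j) (s≤s z≤n) (countBelow<∣∣ j A)
    (λ x∈A x∈[j] → j∉A (subst (_∈ ind A) (singleton⁻ x∈[j]) x∈A))

-- An empty side (L = ∅ or R = ∅) is represented by nothing.
mind : Maybe Term → List ℕ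
mind = maybe ind []

attachˡ : Term → Maybe Term → Term
attachˡ X nothing  = X
attachˡ X (just L) = X ∘[ 1 ] L

attachʳ : Term → Maybe Term → Term
attachʳ X nothing  = X
attachʳ X (just R) = X ∘[ 2 ] R

graft : ℕ → Maybe Term → Maybe Term → Term
graft i mL mR = attachˡ (attachʳ (two i) mR) mL

ind-attachˡ : ∀ X mL → ind (attachˡ X mL) ≡ ind X ++ mind mL
ind-attachˡ X nothing  = sym (++-identityʳ (ind X))
ind-attachˡ X (just L) = refl

ind-attachʳ : ∀ X mR → ind (attachʳ X mR) ≡ ind X ++ mind mR
ind-attachʳ X nothing  = sym (++-identityʳ (ind X))
ind-attachʳ X (just R) = refl

ind-graft : ∀ i mL mR → ind (graft i mL mR) ≡ i ∷ mind mR ++ mind mL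
ind-graft i mL mR = trans (ind-attachˡ _ mL) (cong (_++ mind mL) (ind-attachʳ (two i) mR))

extend : Maybe Term → ℕ → Term
extend nothing  j = two j
extend (just X) j = X ∘[ suc (countBelow j X) ] two j

ind-extend : ∀ m j → ind (extend m j) ≡ mind m ∷ʳ j
ind-extend nothing  j = refl
ind-extend (just X) j = refl

extend-lfactor : ∀ m → Maybe.All LFactor m → 1 ≤ j → j ∉ mind m → LFactor (extend m j)
extend-lfactor nothing  _               1≤j _   = lf-two 1≤j
extend-lfactor (just X) (Maybe.just lf) 1≤j j∉X = lf-step lf 1≤j j∉X

wf-attachˡ⁻ : ∀ mL → WF (attachˡ Y mL) → WF Y
wf-attachˡ⁻ nothing  w                     = w
wf-attachˡ⁻ (just L) (wf-comp wY _ _ _ _) = wY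

attachˡ-cong : ∀ mL → WF (attachˡ Y mL) → Y =I Y′ → attachˡ Y mL =I attachˡ Y′ mL
attachˡ-cong nothing  _                       Y=Y′ = Y=Y′
attachˡ-cong (just L) w@(wf-comp _ wL _ _ _) Y=Y′ = ≈cong w Y=Y′ (≈refl wL)

attachˡ-push : ∀ mL → WF (attachˡ Y mL ∘[ suc (count< j (mind mL)) ] two j) →
               attachˡ Y mL ∘[ suc (count< j (mind mL)) ] two j =I attachˡ Y (just (extend mL j))
attachˡ-push nothing  w = ≈refl w
attachˡ-push {j = j} (just L) w = assoc1-at w (countBelow<∣∣ j L)

attachˡ-skip : ∀ mL → WF (attachˡ Y mL ∘[ suc (length (mind mL) + k) ] C) → 1 ≤ k →
               attachˡ Y mL ∘[ suc (length (mind mL) + k) ] C =I attachˡ (Y ∘[ suc k ] C) mL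
attachˡ-skip nothing  w _   = ≈refl w
attachˡ-skip (just L) w 1≤k = assoc2-at w 1≤k

attachʳ-push : ∀ mR → let r = suc (suc (count< j (mind mR))) in
               WF (attachʳ Y mR ∘[ r ] two j) →
               attachʳ Y mR ∘[ r ] two j =I attachʳ Y (just (extend mR j))
attachʳ-push nothing  w = ≈refl w
attachʳ-push {j = j} (just R) w = assoc1-at w (countBelow<∣∣ j R)

graft-pushʳ : ∀ mL mR → let r = suc (length (mind mL) + suc (count< j (mind mR))) in
              WF (graft i mL mR ∘[ r ] two j) →
              graft i mL mR ∘[ r ] two j =I graft i mL (just (extend mR j))
graft-pushʳ {j} {i} mL mR w =
  ≈trans skipped (attachˡ-cong mL wf-skipped (attachʳ-push mR (wf-attachˡ⁻ mL wf-skipped)))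
  where
  c : ℕ
  c = count< j (mind mR)
  skipped : graft i mL mR ∘[ suc (length (mind mL) + suc c) ] two j
            =I attachˡ (attachʳ (two i) mR ∘[ suc (suc c) ] two j) mL
  skipped = attachˡ-skip mL w (s≤s z≤n)
  wf-skipped : WF (attachˡ (attachʳ (two i) mR ∘[ suc (suc c) ] two j) mL)
  wf-skipped = proj₂ (=I⇒WF skipped)

record RootSplit (A : Term) (mL mR : Maybe Term) : Set where
  field
    lfactorˡ : Maybe.All LFactor mL
    lfactorʳ : Maybe.All LFactor mR
    belowˡ   : All (_< root A) (mind mL)
    aboveʳ   : All (root A <_) (mind mR)
    equiv    : A =I graft (root A) mL mR

  ind-↭ : ind A ↭ root A ∷ mind mR ++ mind mL
  ind-↭ = ↭-trans (=I⇒ind-↭ equiv) (↭-reflexive (ind-graft (root A) mL mR))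

  ∈ˡ⇒∈ind : ∀ {x} → x ∈ mind mL → x ∈ ind A
  ∈ˡ⇒∈ind x∈L = ∈-resp-↭ (↭-sym ind-↭) (there (∈-++⁺ʳ (mind mR) x∈L))

  ∈ʳ⇒∈ind : ∀ {x} → x ∈ mind mR → x ∈ ind A
  ∈ʳ⇒∈ind x∈R = ∈-resp-↭ (↭-sym ind-↭) (there (∈-++⁺ˡ x∈R))

  specˡ : ∀ x → x ∈ mind mL ⇔ (x ∈ ind A × x < root A)
  specˡ x = mk⇔ (λ x∈L → ∈ˡ⇒∈ind x∈L , All.lookup belowˡ x∈L) from-ind
    where
    from-ind : x ∈ ind A × x < root A → x ∈ mind mL
    from-ind (x∈A , x<i) with ∈-resp-↭ ind-↭ x∈A
    ... | here x≡i = ⊥-elim (<-irrefl x≡i x<i)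
    ... | there x∈RL with ∈-++⁻ (mind mR) x∈RL
    ...   | inj₁ x∈R = ⊥-elim (<-asym x<i (All.lookup aboveʳ x∈R))
    ...   | inj₂ x∈L = x∈L

  specʳ : ∀ x → x ∈ mind mR ⇔ (x ∈ ind A × root A < x)
  specʳ x = mk⇔ (λ x∈R → ∈ʳ⇒∈ind x∈R , All.lookup aboveʳ x∈R) from-ind
    where
    from-ind : x ∈ ind A × root A < x → x ∈ mind mR
    from-ind (x∈A , i<x) with ∈-resp-↭ ind-↭ x∈A
    ... | here x≡i = ⊥-elim (<-irrefl (sym x≡i) i<x)
    ... | there x∈RL with ∈-++⁻ (mind mR) x∈RL
    ...   | inj₁ x∈R = x∈R
    ...   | inj₂ x∈L = ⊥-elim (<-asym i<x (All.lookup belowˡ x∈L))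

  ∘-equiv : m ≡ n → WF (A ∘[ m ] C) → A ∘[ m ] C =I graft (root A) mL mR ∘[ n ] C
  ∘-equiv refl w@(wf-comp _ wC _ _ _) = ≈cong w equiv (≈refl wC)

open RootSplit

extendˡ : ∀ {mL mR} → RootSplit A mL mR → WF (A ∘[ suc (countBelow j A) ] two j) → j < root A →
          RootSplit (A ∘[ suc (countBelow j A) ] two j) (just (extend mL j)) mR
extendˡ {A} {j} {mL} {mR} s w@(wf-comp _ (wf-two 1≤j) _ _ disjoint) j<i = record
  { lfactorˡ = Maybe.just (extend-lfactor mL (lfactorˡ s) 1≤j (λ j∈L → j∉A (∈ˡ⇒∈ind s j∈L)))
  ; lfactorʳ = lfactorʳ s
  ; belowˡ   = subst (All (_< root A)) (sym (ind-extend mL j)) (∷ʳ⁺ (belowˡ s) j<i)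
  ; aboveʳ   = aboveʳ s
  ; equiv    = ≈trans moved (attachˡ-push mL (proj₂ (=I⇒WF moved)))
  }
  where
  j∉A : j ∉ ind A
  j∉A j∈A = disjoint j∈A (here refl)
  position : countBelow j A ≡ count< j (mind mL)
  position = trans (count<-resp-↭ j (ind-↭ s)) (count<-∷-++-above (mind mL) j<i (aboveʳ s))
  moved : A ∘[ suc (countBelow j A) ] two j =I graft (root A) mL mR ∘[ suc (count< j (mind mL)) ] two j
  moved = ∘-equiv s (cong suc position) w

extendʳ : ∀ {mL mR} → RootSplit A mL mR → WF (A ∘[ suc (countBelow j A) ] two j) → root A < j →
          RootSplit (A ∘[ suc (countBelow j A) ] two j) mL (just (extend mR j))
extendʳ {A} {j} {mL} {mR} s w@(wf-comp _ (wf-two 1≤j) _ _ disjoint) i<j = record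
  { lfactorˡ = lfactorˡ s
  ; lfactorʳ = Maybe.just (extend-lfactor mR (lfactorʳ s) 1≤j (λ j∈R → j∉A (∈ʳ⇒∈ind s j∈R)))
  ; belowˡ   = belowˡ s
  ; aboveʳ   = subst (All (root A <_)) (sym (ind-extend mR j)) (∷ʳ⁺ (aboveʳ s) i<j)
  ; equiv    = ≈trans moved (graft-pushʳ mL mR (proj₂ (=I⇒WF moved)))
  }
  where
  j∉A : j ∉ ind A
  j∉A j∈A = disjoint j∈A (here refl)
  position : countBelow j A ≡ length (mind mL) + suc (count< j (mind mR))
  position = trans (count<-resp-↭ j (ind-↭ s)) (count<-∷-++-below (mind mR) i<j (belowˡ s))
  moved : A ∘[ suc (countBelow j A) ] two j
          =I graft (root A) mL mR ∘[ suc (length (mind mL) + suc (count< j (mind mR))) ] two j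
  moved = ∘-equiv s (cong suc position) w

rootSplit : LFactor A → ∃₂ (RootSplit A)
rootSplit (lf-two 1≤k) = nothing , nothing , record
  { lfactorˡ = Maybe.nothing
  ; lfactorʳ = Maybe.nothing
  ; belowˡ   = All.[]
  ; aboveʳ   = All.[]
  ; equiv    = ≈refl (wf-two 1≤k)
  }
rootSplit (lf-step {A} {j} lf 1≤j j∉A) with rootSplit lf | <-cmp j (root A)
... | _  , _  , _ | tri≈ _ j≡i _ = ⊥-elim (j∉A (subst (_∈ ind A) (sym j≡i) (root∈ind A)))
... | mL , mR , s | tri< j<i _ _ = just (extend mL j) , mR , extendˡ s (lfactor⇒WF (lf-step lf 1≤j j∉A)) j<i
... | mL , mR , s | tri> _ _ i<j = mL , just (extend mR j) , extendʳ s (lfactor⇒WF (lf-step lf 1≤j j∉A)) i<j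

inhabited : ∀ {P : ℕ → Set} X → (∀ x → x ∈ ind X ⇔ P x) → ∃ P
inhabited X spec = root X , to (spec (root X)) (root∈ind X)

uninhabited : ∀ {P : ℕ → Set} → (∀ x → x ∈ [] ⇔ P x) → ¬ ∃ P
uninhabited spec (x , px) with () ← from (spec x) px

singleton-ind : LFactor A → (∀ x → x ∈ ind A ⇔ x ≡ root A) → A ≡ two (root A)
singleton-ind (lf-two _) _ = refl
singleton-ind (lf-step {A} _ _ j∉A) spec =
  ⊥-elim (j∉A (subst (_∈ ind A) (sym (to (spec _) (∈-++⁺ʳ (ind A) (here refl)))) (root∈ind A)))

lemma3p3 : (A : Term) → LFactor A →
    ((∃ λ x → x ∈ ind A × x < root A) × (∃ λ x → x ∈ ind A × root A < x) →
      Σ Term λ AL → Σ Term λ AR →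
        LFactor AL × (∀ x → (x ∈ ind AL) ⇔ (x ∈ ind A × x < root A)) ×
        LFactor AR × (∀ x → (x ∈ ind AR) ⇔ (x ∈ ind A × root A < x)) ×
        (A =I ((two (root A) ∘[ 2 ] AR) ∘[ 1 ] AL)))
    × ((¬ (∃ λ x → x ∈ ind A × x < root A)) × (∃ λ x → x ∈ ind A × root A < x) →
      Σ Term λ AR →
        LFactor AR × (∀ x → (x ∈ ind AR) ⇔ (x ∈ ind A × root A < x)) ×
        (A =I (two (root A) ∘[ 2 ] AR)))
    × ((¬ (∃ λ x → x ∈ ind A × root A < x)) × (∃ λ x → x ∈ ind A × x < root A) →
      Σ Term λ AL →
        LFactor AL × (∀ x → (x ∈ ind AL) ⇔ (x ∈ ind A × x < root A)) ×
        (A =I (two (root A) ∘[ 1 ] AL)))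
    × ((∀ x → (x ∈ ind A) ⇔ (x ≡ root A)) → A ≡ two (root A))
lemma3p3 A lf with rootSplit lf
... | just L , just R , s =
      (λ _ → L , R , Maybe.drop-just (lfactorˡ s) , specˡ s
                   , Maybe.drop-just (lfactorʳ s) , specʳ s , equiv s)
    , (λ (∄L , _) → ⊥-elim (∄L (inhabited L (specˡ s))))
    , (λ (∄R , _) → ⊥-elim (∄R (inhabited R (specʳ s))))
    , singleton-ind lf
... | nothing , just R , s =
      (λ (∃L , _) → ⊥-elim (uninhabited (specˡ s) ∃L))
    , (λ _ → R , Maybe.drop-just (lfactorʳ s) , specʳ s , equiv s)
    , (λ (∄R , _) → ⊥-elim (∄R (inhabited R (specʳ s))))
    , singleton-ind lf
... | just L , nothing , s =
      (λ (_ , ∃R) → ⊥-elim (uninhabited (specʳ s) ∃R))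
    , (λ (∄L , _) → ⊥-elim (∄L (inhabited L (specˡ s))))
    , (λ _ → L , Maybe.drop-just (lfactorˡ s) , specˡ s , equiv s)
    , singleton-ind lf
... | nothing , nothing , s =
      (λ (∃L , _) → ⊥-elim (uninhabited (specˡ s) ∃L))
    , (λ (_ , ∃R) → ⊥-elim (uninhabited (specʳ s) ∃R))
    , (λ (_ , ∃L) → ⊥-elim (uninhabited (specˡ s) ∃L))
    , singleton-ind lf
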